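{- Suppose $(i,j)$ is an admissible edge of the area sequence $\mathbf{a}$, set $\mathbf{a}^1 \coloneqq \mathbf{a}-\mathbf{e}_j$ and $\mathbf{a}^2 \coloneqq \mathbf{a}-2\mathbf{e}_j$ and $\mathbf{s}^1 \coloneqq \{(i,j)\}$, $\mathbf{s}^2 \coloneqq \{(i+1,j)\}$. Then \begin{align*} \mathrm{G}_{\mathbf{a}^1,\mathbf{s}^1}(\mathbf{x};q) = q\mathrm{G}_{\mathbf{a}^2,\mathbf{s}^2}(\mathbf{x};q). \end{align*}
   Context: An area sequence is $\mathbf{a}=(a_1,\dotsc,a_n)$ with $0\le a_i\le i-1$ and $a_{i+1}\le a_i+1$; $\Gamma_\mathbf{a}$ has vertex set $[n]$ and directed edges $k\to m$ for $m-a_m\le k\le m-1$. An outer corner $(u,v)$, $u<v$, is a non-edge with $u+1=v$ or with $(u+1,v)$, $(u,v-1)$ both edges. For a set $\mathbf{s}$ of outer corners (strict edges), a valid coloring is $\kappa:[n]\to\mathbb{N}$ with $\kappa(u)<\kappa(v)$ for strict $(u,v)$; $\mathrm{asc}(\kappa)$ counts edges $(u,v)$ of $\Gamma_\mathbf{a}$ (not strict edges) with $\kappa(u)<\kappa(v)$; $\mathrm{G}_{\mathbf{a},\mathbf{s}}(\mathbf{x};q)=\sum_\kappa \mathbf{x}^\kappa q^{\mathrm{asc}(\kappa)}$ over valid colorings. For $n\ge 3$, an edge $(i,j)$ of $\Gamma_\mathbf{a}$ with $3\le j\le n$ is admissible if $i=j-a_j$; $j=n$ or $a_j\ge a_{j+1}+1$;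 $a_j\ge 2$; and $a_i+1=a_{i+1}$. $\mathbf{e}_j$ is the $j$th unit vector. -}

module Defs where

open import Data.Nat using (ℕ; zero; suc; _+_; _∸_; _≤_; _<_; _≤?_; _<?_; _≟_)
open import Data.Bool using (if_then_else_)
open import Data.List using (List; []; _∷_; map; concatMap; upTo; filter; length)
open import Data.List.Relation.Unary.All using (All)
open import Data.Product using (_×_; _,_; proj₁; proj₂)
open import Data.Sum using (_⊎_)
open import Relation.Binary.PropositionalEquality using (_≡_)
open import Relation.Nullary using (Dec; does)
open import Relation.Nullary.Decidable using (_×-dec_)

-- Vertices of Γ_a are 1,…,n (1-based, as in the paper).
-- An area sequence of length n is a function a : ℕ → ℕ, where a i is a_i for
-- 1 ≤ i ≤ n (values outside [1,n] are irrelevant).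

IsAreaSeq : ℕ → (ℕ → ℕ) → Set
IsAreaSeq n a =
  (∀ i → 1 ≤ i → i ≤ n → a i ≤ i ∸ 1) ×
  (∀ i → 1 ≤ i → suc i ≤ n → a (suc i) ≤ a i + 1)

subAt : (ℕ → ℕ) → ℕ → ℕ → (ℕ → ℕ)
subAt a j c i = if does (i ≟ j) then a i ∸ c else a i

Edge : ℕ → (ℕ → ℕ) → ℕ → ℕ → Set
Edge n a k m = (1 ≤ k) × (m ≤ n) × (m ∸ a m ≤ k) × (k < m)

edge? : ∀ n a k m → Dec (Edge n a k m)
edge? n a k m = (1 ≤? k) ×-dec ((m ≤? n) ×-dec ((m ∸ a m ≤? k) ×-dec (k <? m)))

Admissible : ℕ → (ℕ → ℕ) → ℕ → ℕ → Set
Admissible n a i j =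
  Edge n a i j × 3 ≤ j × j ≤ n × i ≡ j ∸ a j ×
  (j ≡ n ⊎ a (suc j) + 1 ≤ a j) × 2 ≤ a j × a i + 1 ≡ a (suc i)

-- Colorings κ : [n] → {0,…,m-1} represented as lists of length n
-- (entry at position v-1 is κ(v)).
nth : List ℕ → ℕ → ℕ
nth []       _       = 0
nth (x ∷ xs) zero    = x
nth (x ∷ xs) (suc k) = nth xs k

col : List ℕ → ℕ → ℕ
col κ v = nth κ (v ∸ 1)

allColorings : ℕ → ℕ → List (List ℕ)
allColorings m zero    = [] ∷ []
allColorings m (suc n) = concatMap (λ c → map (c ∷_) (allColorings m n)) (upTo m)

-- all pairs (u,v) with u < v ≤ n (u may be 0; such pairs are never edges)
allPairs : ℕ → List (ℕ × ℕ)
allPairs n = concatMap (λ v → map (λ u → (u , v)) (upTo v)) (upTo (suc n))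

Valid : List (ℕ × ℕ) → List ℕ → Set
Valid s κ = All (λ p → col κ (proj₁ p) < col κ (proj₂ p)) s

valid? : ∀ s κ → Dec (Valid s κ)
valid? s κ = Data.List.Relation.Unary.All.all? (λ p → col κ (proj₁ p) <? col κ (proj₂ p)) s

asc : ℕ → (ℕ → ℕ) → List ℕ → ℕ
asc n a κ = length (filter (λ p → edge? n a (proj₁ p) (proj₂ p) ×-dec (col κ (proj₁ p) <? col κ (proj₂ p))) (allPairs n))

-- content of κ: exponent vector (multiplicity of colours 0,…,m-1), i.e. x^κ
content : ℕ → List ℕ → List ℕ
content m κ = map (λ c → length (filter (λ x → x ≟ c) κ)) (upTo m)

-- G_{a,s}(x_0,…,x_{m-1},0,0,…; q) as the multiset of its monomials
-- x^{content κ} q^{asc κ}, κ ranging over valid colorings with colours < m.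
-- Two polynomials with coefficients in ℕ are equal iff these multisets agree
-- up to permutation; power series in x agree iff all truncations m agree.
G : ℕ → ℕ → (ℕ → ℕ) → List (ℕ × ℕ) → List (List ℕ × ℕ)
G m n a s = map (λ κ → content m κ , asc n a κ) (filter (valid? s) (allColorings m n))

timesQ : List (List ℕ × ℕ) → List (List ℕ × ℕ)
timesQ = map (λ p → proj₁ p , suc (proj₂ p))

module Submission where

-- Write a1 = a − e_j and a2 = a − 2e_j.  The in-neighbourhood of j starts at
-- i + 1 in Γ(a1) and at i + 2 in Γ(a2), so Γ(a1) is Γ(a2) plus the edge
-- i+1 → j; a colouring with κ(i+1) < κ(j) therefore has one more ascent for a1.
-- The bijection φ from {(i,j)}-valid to {(i+1,j)}-valid colourings swaps the
-- colours of i and i+1 when κ(j) straddles them and is the identity otherwise.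
-- It preserves the content, and the a1-ascents: admissibility makes the
-- transposition τ = (i i+1) an automorphism of Γ(a1) away from the edges
-- (i,i+1), (i+1,j), (i,j), so an involution π of pairs matches the ascents.
-- Both bijections become list permutations through one general fact: an
-- involution of a duplicate-free list carrying the P-elements onto the
-- Q-elements permutes the P-sublist onto the Q-sublist (filter-involution-↭).

open import Defs
open import Data.Nat using (ℕ; zero; suc; _+_; _∸_; _≤_; _<_; z≤n; s≤s; _≟_; _<?_; _≤?_)
open import Data.Nat.Properties
open import Data.List using (List; []; _∷_; map; filter; concatMap; length; upTo)
open import Data.List.Properties using (length-map; map-cong; map-cong-local; map-∘)
open import Data.List.Membership.Propositional using (_∈_; find; lose)
open import Data.List.Membership.Propositional.Properties
  using (∈-map⁺; ∈-map⁻; ∈-concatMap⁺; ∈-concatMap⁻; ∈-upTo⁺; ∈-upTo⁻; ∈-filter⁻)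
open import Data.List.Membership.Propositional.Properties.WithK using (unique∧set⇒bag)
open import Data.List.Relation.Unary.Any using (here; there)
open import Data.List.Relation.Unary.All as All using (All; []; _∷_)
open import Data.List.Relation.Unary.All.Properties as All using ()
open import Data.List.Relation.Unary.AllPairs using ([]; _∷_)
open import Data.List.Relation.Unary.Unique.Propositional using (Unique)
open import Data.List.Relation.Unary.Unique.Propositional.Properties
  using (++⁺; upTo⁺) renaming (map⁺ to unique-map⁺)
open import Data.List.Relation.Binary.BagAndSetEquality using (∼bag⇒↭)
open import Data.List.Relation.Binary.Permutation.Propositional
  using (_↭_; ↭-refl; ↭-sym; prep; swap; module PermutationReasoning)
open import Data.List.Relation.Binary.Permutation.Propositional.Properties
  using (filter-↭; ↭-length; All-resp-↭) renaming (map⁺ to ↭-map⁺)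
open import Data.Product using (_×_; _,_; proj₁; proj₂)
open import Data.Product.Properties using (≡-dec)
open import Data.Product.Function.NonDependent.Propositional using (_×-⇔_)
open import Data.Sum using (_⊎_; inj₁; inj₂)
open import Data.Empty using (⊥; ⊥-elim)
open import Data.Bool using (true; false; if_then_else_)
open import Function.Bundles using (_⇔_; mk⇔; Equivalence)
open import Function.Construct.Symmetry using (⇔-sym)
open import Function.Construct.Identity using (⇔-id)
open import Function.Construct.Composition using (_⇔-∘_)
open import Relation.Binary.PropositionalEquality
open import Relation.Binary.Definitions using (tri<; tri≈; tri>)
open import Relation.Nullary using (Dec; yes; no; does; ¬_)
open import Relation.Nullary.Decidable using (dec-true; dec-false; map′; _×-dec_; _⊎-dec_)
open import Function.Base using (_∘_)
open import Relation.Unary using (Pred; Decidable)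
open import Level using (0ℓ)

concatMap-unique : {A B : Set} (f : A → List B) (key : B → A) →
  (∀ x → Unique (f x)) → (∀ {x y} → y ∈ f x → key y ≡ x) →
  ∀ {xs} → Unique xs → Unique (concatMap f xs)
concatMap-unique f key unique-f key-f {[]} [] = []
concatMap-unique f key unique-f key-f {x ∷ xs} (x∉xs ∷ unique-xs) =
  ++⁺ (unique-f x) (concatMap-unique f key unique-f key-f unique-xs) disjoint
  where
  disjoint : ∀ {y} → ¬ (y ∈ f x × y ∈ concatMap f xs)
  disjoint (y∈fx , y∈rest) with x′ , x′∈xs , y∈fx′ ← find (∈-concatMap⁻ f y∈rest) =
    All.lookup x∉xs x′∈xs (trans (sym (key-f y∈fx)) (key-f y∈fx′))

map-unique-local : {A B : Set} (f : A → B) {xs : List A} → Unique xs →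
  (∀ {x y} → x ∈ xs → y ∈ xs → f x ≡ f y → x ≡ y) → Unique (map f xs)
map-unique-local f {[]} [] injective = []
map-unique-local f {x ∷ xs} (x∉xs ∷ unique-xs) injective =
  All.map⁺ (All.tabulate λ y∈xs fx≡fy → All.lookup x∉xs y∈xs (injective (here refl) (there y∈xs) fx≡fy))
  ∷ map-unique-local f unique-xs (λ x∈ y∈ → injective (there x∈) (there y∈))

involution-↭ : {A : Set} (f : A → A) {xs : List A} → Unique xs →
  (∀ {x} → x ∈ xs → f x ∈ xs) → (∀ {x} → x ∈ xs → f (f x) ≡ x) → xs ↭ map f xs
involution-↭ f {xs} unique-xs closed involutive =
  ∼bag⇒↭ (unique∧set⇒bag unique-xs (map-unique-local f unique-xs injective) (mk⇔ to from))
  where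
  injective : ∀ {x y} → x ∈ xs → y ∈ xs → f x ≡ f y → x ≡ y
  injective x∈ y∈ fx≡fy = trans (sym (involutive x∈)) (trans (cong f fx≡fy) (involutive y∈))
  to : ∀ {x} → x ∈ xs → x ∈ map f xs
  to x∈ = subst (_∈ map f xs) (involutive x∈) (∈-map⁺ f (closed x∈))
  from : ∀ {y} → y ∈ map f xs → y ∈ xs
  from y∈ with x , x∈ , refl ← ∈-map⁻ f y∈ = closed x∈

filter-map : {A B : Set} {P : Pred B 0ℓ} (P? : Decidable P) (f : A → B) (xs : List A) →
  filter P? (map f xs) ≡ map f (filter (λ x → P? (f x)) xs)
filter-map P? f [] = refl
filter-map P? f (x ∷ xs) with does (P? (f x))
... | true  = cong (f x ∷_) (filter-map P? f xs)
... | false = filter-map P? f xs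

filter-cong-local : {A : Set} {P Q : Pred A 0ℓ} (P? : Decidable P) (Q? : Decidable Q) (xs : List A) →
  (∀ {x} → x ∈ xs → P x ⇔ Q x) → filter P? xs ≡ filter Q? xs
filter-cong-local P? Q? [] P⇔Q = refl
filter-cong-local P? Q? (x ∷ xs) P⇔Q with P? x | Q? x | P⇔Q (here refl)
... | yes _  | yes _  | _ = cong (x ∷_) (filter-cong-local P? Q? xs (λ x∈ → P⇔Q (there x∈)))
... | no _   | no _   | _ = filter-cong-local P? Q? xs (λ x∈ → P⇔Q (there x∈))
... | yes px | no ¬qx | e = ⊥-elim (¬qx (Equivalence.to e px))
... | no ¬px | yes qx | e = ⊥-elim (¬px (Equivalence.from e qx))

filter-involution-↭ : {A : Set} {P Q : Pred A 0ℓ} (P? : Decidable P) (Q? : Decidable Q)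
  (f : A → A) {xs : List A} → Unique xs →
  (∀ {x} → x ∈ xs → f x ∈ xs) → (∀ {x} → x ∈ xs → f (f x) ≡ x) →
  (∀ {x} → x ∈ xs → Q (f x) ⇔ P x) → map f (filter P? xs) ↭ filter Q? xs
filter-involution-↭ P? Q? f {xs} unique-xs closed involutive Qf⇔P = begin
  map f (filter P? xs)                 ≡⟨ cong (map f) (filter-cong-local P? (λ x → Q? (f x)) xs (λ x∈ → ⇔-sym (Qf⇔P x∈))) ⟩
  map f (filter (λ x → Q? (f x)) xs)   ≡⟨ filter-map Q? f xs ⟨
  filter Q? (map f xs)                 ↭⟨ filter-↭ Q? (↭-sym (involution-↭ f unique-xs closed involutive)) ⟩
  filter Q? xs                         ∎
  where open PermutationReasoning

count-one-more : {A : Set} {P Q : Pred A 0ℓ} (P? : Decidable P) (Q? : Decidable Q)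
  {x₀ : A} (xs : List A) → Unique xs → x₀ ∈ xs →
  (∀ {x} → x ∈ xs → x ≢ x₀ → P x ⇔ Q x) → P x₀ → ¬ Q x₀ →
  length (filter P? xs) ≡ suc (length (filter Q? xs))
count-one-more P? Q? (x ∷ xs) (x∉xs ∷ _) (here refl) P⇔Q px₀ ¬qx₀
  rewrite dec-true (P? x) px₀ | dec-false (Q? x) ¬qx₀ =
  cong (suc ∘ length) (filter-cong-local P? Q? xs (λ y∈ → P⇔Q (there y∈) (λ y≡x → All.lookup x∉xs y∈ (sym y≡x))))
count-one-more P? Q? (x ∷ xs) (x∉xs ∷ unique-xs) (there x₀∈xs) P⇔Q px₀ ¬qx₀
  with P? x | Q? x | P⇔Q (here refl) (All.lookup x∉xs x₀∈xs)
... | yes _  | yes _  | _ = cong suc (count-one-more P? Q? xs unique-xs x₀∈xs (λ y∈ → P⇔Q (there y∈)) px₀ ¬qx₀)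
... | no _   | no _   | _ = count-one-more P? Q? xs unique-xs x₀∈xs (λ y∈ → P⇔Q (there y∈)) px₀ ¬qx₀
... | yes px | no ¬qx | e = ⊥-elim (¬qx (Equivalence.to e px))
... | no ¬px | yes qx | e = ⊥-elim (¬px (Equivalence.from e qx))

allPairs-∈⁻ : ∀ n {u v} → (u , v) ∈ allPairs n → u < v × v ≤ n
allPairs-∈⁻ n p∈ with find (∈-concatMap⁻ (λ v → map (_, v) (upTo v)) {xs = upTo (suc n)} p∈)
... | v , v∈ , p∈block with ∈-map⁻ (_, v) p∈block
...   | u , u∈ , refl = ∈-upTo⁻ u∈ , ≤-pred (∈-upTo⁻ v∈)

allPairs-∈⁺ : ∀ n {u v} → u < v → v ≤ n → (u , v) ∈ allPairs n
allPairs-∈⁺ n {u} {v} u<v v≤n =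
  ∈-concatMap⁺ (λ v → map (_, v) (upTo v)) (lose (∈-upTo⁺ (s≤s v≤n)) (∈-map⁺ (_, v) (∈-upTo⁺ u<v)))

allPairs-unique : ∀ n → Unique (allPairs n)
allPairs-unique n = concatMap-unique (λ v → map (_, v) (upTo v)) proj₂
  (λ v → unique-map⁺ (cong proj₁) (upTo⁺ v)) second-is-v (upTo⁺ (suc n))
  where
  second-is-v : ∀ {v p} → p ∈ map (_, v) (upTo v) → proj₂ p ≡ v
  second-is-v {v} p∈ with _ , _ , refl ← ∈-map⁻ (_, v) p∈ = refl

Coloring : ℕ → ℕ → List ℕ → Set
Coloring m n κ = length κ ≡ n × All (_< m) κ

allColorings-∈⁻ : ∀ m n {κ} → κ ∈ allColorings m n → Coloring m n κ
allColorings-∈⁻ m zero (here refl) = refl , []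
allColorings-∈⁻ m (suc n) κ∈
  with find (∈-concatMap⁻ (λ c → map (c ∷_) (allColorings m n)) {xs = upTo m} κ∈)
... | c , c∈ , κ∈block with ∈-map⁻ (c ∷_) κ∈block
...   | κ′ , κ′∈ , refl with allColorings-∈⁻ m n κ′∈
...     | length≡ , bounded = cong suc length≡ , ∈-upTo⁻ c∈ ∷ bounded

allColorings-∈⁺ : ∀ m n {κ} → Coloring m n κ → κ ∈ allColorings m n
allColorings-∈⁺ m zero {[]} _ = here refl
allColorings-∈⁺ m (suc n) {c ∷ κ} (length≡ , c<m ∷ bounded) =
  ∈-concatMap⁺ (λ c → map (c ∷_) (allColorings m n))
    (lose (∈-upTo⁺ c<m) (∈-map⁺ (c ∷_) (allColorings-∈⁺ m n (suc-injective length≡ , bounded))))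

allColorings-unique : ∀ m n → Unique (allColorings m n)
allColorings-unique m zero = [] ∷ []
allColorings-unique m (suc n) = concatMap-unique (λ c → map (c ∷_) (allColorings m n)) head
  (λ c → unique-map⁺ (cong tail) (allColorings-unique m n)) head-is-c (upTo⁺ m)
  where
  head : List ℕ → ℕ
  head []      = 0
  head (c ∷ _) = c
  tail : List ℕ → List ℕ
  tail []      = []
  tail (_ ∷ κ) = κ
  head-is-c : ∀ {c κ} → κ ∈ map (c ∷_) (allColorings m n) → head κ ≡ c
  head-is-c {c} κ∈ with _ , _ , refl ← ∈-map⁻ (c ∷_) κ∈ = refl

transpose : ℕ → ℕ → ℕ
transpose zero    zero          = 1
transpose zero    (suc zero)    = 0
transpose zero    (suc (suc w)) = suc (suc w)
transpose (suc k) zero          = 0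
transpose (suc k) (suc w)       = suc (transpose k w)

transpose-k : ∀ k → transpose k k ≡ suc k
transpose-k zero    = refl
transpose-k (suc k) = cong suc (transpose-k k)

transpose-suc-k : ∀ k → transpose k (suc k) ≡ k
transpose-suc-k zero    = refl
transpose-suc-k (suc k) = cong suc (transpose-suc-k k)

transpose-other : ∀ k w → w ≢ k → w ≢ suc k → transpose k w ≡ w
transpose-other zero    zero          w≢k _     = ⊥-elim (w≢k refl)
transpose-other zero    (suc zero)    _   w≢1+k = ⊥-elim (w≢1+k refl)
transpose-other zero    (suc (suc w)) _   _     = refl
transpose-other (suc k) zero          _   _     = refl
transpose-other (suc k) (suc w)       w≢k w≢1+k =
  cong suc (transpose-other k w (w≢k ∘ cong suc) (w≢1+k ∘ cong suc))

transpose-involutive : ∀ k w → transpose k (transpose k w) ≡ w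
transpose-involutive zero    zero          = refl
transpose-involutive zero    (suc zero)    = refl
transpose-involutive zero    (suc (suc w)) = refl
transpose-involutive (suc k) zero          = refl
transpose-involutive (suc k) (suc w)       = cong suc (transpose-involutive k w)

swapAdjacent : ℕ → List ℕ → List ℕ
swapAdjacent zero    (x ∷ y ∷ xs) = y ∷ x ∷ xs
swapAdjacent (suc k) (x ∷ xs)     = x ∷ swapAdjacent k xs
swapAdjacent _       xs           = xs

swapAdjacent-↭ : ∀ k xs → swapAdjacent k xs ↭ xs
swapAdjacent-↭ zero    []           = ↭-refl
swapAdjacent-↭ zero    (x ∷ [])     = ↭-refl
swapAdjacent-↭ zero    (x ∷ y ∷ xs) = swap y x ↭-refl
swapAdjacent-↭ (suc k) []           = ↭-refl
swapAdjacent-↭ (suc k) (x ∷ xs)     = prep x (swapAdjacent-↭ k xs)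

swapAdjacent-involutive : ∀ k xs → swapAdjacent k (swapAdjacent k xs) ≡ xs
swapAdjacent-involutive zero    []           = refl
swapAdjacent-involutive zero    (x ∷ [])     = refl
swapAdjacent-involutive zero    (x ∷ y ∷ xs) = refl
swapAdjacent-involutive (suc k) []           = refl
swapAdjacent-involutive (suc k) (x ∷ xs)     = cong (x ∷_) (swapAdjacent-involutive k xs)

swapAdjacent-nth : ∀ k xs → suc k < length xs → ∀ p → nth (swapAdjacent k xs) p ≡ nth xs (transpose k p)
swapAdjacent-nth zero    (x ∷ [])     (s≤s ())  _
swapAdjacent-nth zero    (x ∷ y ∷ xs) _         zero          = refl
swapAdjacent-nth zero    (x ∷ y ∷ xs) _         (suc zero)    = refl
swapAdjacent-nth zero    (x ∷ y ∷ xs) _         (suc (suc p)) = refl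
swapAdjacent-nth (suc k) (x ∷ xs)     _         zero          = refl
swapAdjacent-nth (suc k) (x ∷ xs)     (s≤s k<l) (suc p)       = swapAdjacent-nth k xs k<l p

col-swapAdjacent : ∀ {i} κ → 1 ≤ i → i < length κ →
  ∀ w → 1 ≤ w → col (swapAdjacent (i ∸ 1) κ) w ≡ col κ (transpose i w)
col-swapAdjacent {suc k} κ _ i<l (suc w) _ = swapAdjacent-nth k κ i<l w

content-↭ : ∀ m {κ κ′} → κ ↭ κ′ → content m κ ≡ content m κ′
content-↭ m κ↭κ′ = map-cong (λ c → ↭-length (filter-↭ (_≟ c) κ↭κ′)) (upTo m)

coloring-↭ : ∀ {m n κ κ′} → κ ↭ κ′ → Coloring m n κ → Coloring m n κ′
coloring-↭ κ↭κ′ (length≡ , bounded) = trans (sym (↭-length κ↭κ′)) length≡ , All-resp-↭ κ↭κ′ bounded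

valid-single : ∀ {u v} κ → Valid ((u , v) ∷ []) κ ⇔ col κ u < col κ v
valid-single κ = mk⇔ (λ { (u<v ∷ []) → u<v }) (λ u<v → u<v ∷ [])

holds : ∀ {A B : Set} → A → B → A ⇔ B
holds a b = mk⇔ (λ _ → b) (λ _ → a)

<-resp : ∀ {x x′ y y′} → x′ ≡ x → y′ ≡ y → x′ < y′ ⇔ x < y
<-resp refl refl = ⇔-id _

data Straddles (x y z : ℕ) : Set where
  rises : x < z → z ≤ y → Straddles x y z
  falls : y < z → z ≤ x → Straddles x y z

straddles? : ∀ x y z → Dec (Straddles x y z)
straddles? x y z = map′ from-sum to-sum (((x <? z) ×-dec (z ≤? y)) ⊎-dec ((y <? z) ×-dec (z ≤? x)))
  where
  from-sum : (x < z × z ≤ y) ⊎ (y < z × z ≤ x) → Straddles x y z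
  from-sum (inj₁ (x<z , z≤y)) = rises x<z z≤y
  from-sum (inj₂ (y<z , z≤x)) = falls y<z z≤x
  to-sum : Straddles x y z → (x < z × z ≤ y) ⊎ (y < z × z ≤ x)
  to-sum (rises x<z z≤y) = inj₁ (x<z , z≤y)
  to-sum (falls y<z z≤x) = inj₂ (y<z , z≤x)

straddles-swap : ∀ {x y z} → Straddles x y z → Straddles y x z
straddles-swap (rises x<z z≤y) = falls x<z z≤y
straddles-swap (falls y<z z≤x) = rises y<z z≤x

straddles-compare : ∀ {x y z} → Straddles x y z → (y < z ⇔ y < x) × (x < y ⇔ x < z)
straddles-compare (rises x<z z≤y) =
  mk⇔ (λ y<z → ⊥-elim (<⇒≱ y<z z≤y)) (λ y<x → ⊥-elim (<⇒≱ y<x (<⇒≤ (<-≤-trans x<z z≤y)))) ,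
  mk⇔ (λ _ → x<z) (λ _ → <-≤-trans x<z z≤y)
straddles-compare (falls y<z z≤x) =
  mk⇔ (λ _ → <-≤-trans y<z z≤x) (λ _ → y<z) ,
  mk⇔ (λ x<y → ⊥-elim (<⇒≱ x<y (<⇒≤ (<-≤-trans y<z z≤x)))) (λ x<z → ⊥-elim (<⇒≱ x<z z≤x))

not-straddles : ∀ {x y z} → ¬ Straddles x y z → y < z ⇔ x < z
not-straddles {x} {y} {z} ¬straddles = mk⇔ to from
  where
  to : y < z → x < z
  to y<z with x <? z
  ... | yes x<z = x<z
  ... | no  x≮z = ⊥-elim (¬straddles (falls y<z (≮⇒≥ x≮z)))
  from : x < z → y < z
  from x<z with y <? z
  ... | yes y<z = y<z
  ... | no  y≮z = ⊥-elim (¬straddles (rises x<z (≮⇒≥ y≮z)))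

∸-∸ : ∀ {x y c} → c ≤ y → y ≤ x → x ∸ (y ∸ c) ≡ x ∸ y + c
∸-∸ {x} {y} {c} c≤y y≤x = begin
  x ∸ (y ∸ c)                     ≡⟨ cong (_∸ (y ∸ c)) x≡ ⟨
  x ∸ y + c + (y ∸ c) ∸ (y ∸ c)   ≡⟨ m+n∸n≡m (x ∸ y + c) (y ∸ c) ⟩
  x ∸ y + c                       ∎
  where
  open ≡-Reasoning
  x≡ : x ∸ y + c + (y ∸ c) ≡ x
  x≡ = trans (+-assoc (x ∸ y) c (y ∸ c)) (trans (cong (x ∸ y +_) (m+[n∸m]≡n c≤y)) (m∸n+n≡m y≤x))

subAt-at : ∀ a j c → subAt a j c j ≡ a j ∸ c
subAt-at a j c rewrite dec-true (j ≟ j) refl = refl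

subAt-away : ∀ a j c {w} → w ≢ j → subAt a j c w ≡ a w
subAt-away a j c {w} w≢j rewrite dec-false (w ≟ j) w≢j = refl

edge-transport : ∀ n b b′ {u v} → (v ∸ b v ≤ u → v ∸ b′ v ≤ u) → Edge n b u v → Edge n b′ u v
edge-transport _ _ _ f (1≤u , v≤n , start≤u , u<v) = 1≤u , v≤n , f start≤u , u<v

-- In an area sequence the start v ∸ a v of the in-neighbourhood of v is
-- weakly increasing in v, since a (v + 1) ≤ a v + 1.
start-mono : ∀ {n a} → IsAreaSeq n a → ∀ {v w} → 1 ≤ v → v ≤ w → w ≤ n → v ∸ a v ≤ w ∸ a w
start-mono isArea {v} {zero} 1≤v v≤w _ = ⊥-elim (<-irrefl refl (≤-trans 1≤v v≤w))
start-mono {a = a} isArea {v} {suc w} 1≤v v≤1+w 1+w≤n with m≤n⇒m<n∨m≡n v≤1+w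
... | inj₂ refl      = ≤-refl
... | inj₁ (s≤s v≤w) =
  ≤-trans (start-mono isArea 1≤v v≤w (≤-trans (n≤1+n w) 1+w≤n)) (∸-monoʳ-≤ (suc w) step)
  where
  step : a (suc w) ≤ suc (a w)
  step = subst (a (suc w) ≤_) (+-comm (a w) 1) (proj₂ isArea w (≤-trans 1≤v v≤w) 1+w≤n)

-- Fix an admissible edge (i, j) of the area sequence a; the parameters are the
-- parts of admissibility the proof uses.  a1 = a − e_j and a2 = a − 2e_j, with
-- edge relations E1 of Γ(a1) and E2 of Γ(a2).
module AdmissibleEdge
  (n : ℕ) (a : ℕ → ℕ) (i j : ℕ) (isArea : IsAreaSeq n a)
  (1≤i : 1 ≤ i) (j≤n : j ≤ n) (i≡j∸aj : i ≡ j ∸ a j)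
  (last-or-drop : j ≡ n ⊎ a (suc j) + 1 ≤ a j)
  (2≤aj : 2 ≤ a j) (ai+1≡ai+1 : a i + 1 ≡ a (suc i))
  where

  a1 a2 : ℕ → ℕ
  a1 = subAt a j 1
  a2 = subAt a j 2

  E1 E2 : ℕ → ℕ → Set
  E1 = Edge n a1
  E2 = Edge n a2

  1≤j : 1 ≤ j
  1≤j = ≤-trans 1≤i (subst (_≤ j) (sym i≡j∸aj) (m∸n≤m j (a j)))

  aj≤j : a j ≤ j
  aj≤j = ≤-trans (proj₁ isArea j 1≤j j≤n) (m∸n≤m j 1)

  j≡i+aj : j ≡ i + a j
  j≡i+aj = trans (sym (m∸n+n≡m aj≤j)) (cong (_+ a j) (sym i≡j∸aj))

  2+i≤j : suc (suc i) ≤ j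
  2+i≤j = subst₂ _≤_ (+-comm i 2) (sym j≡i+aj) (+-monoʳ-≤ i 2≤aj)

  1+i≤n : suc i ≤ n
  1+i≤n = ≤-trans (≤-trans (n≤1+n (suc i)) 2+i≤j) j≤n

  i≢j : i ≢ j
  i≢j i≡j = <-irrefl i≡j (≤-trans (n≤1+n (suc i)) 2+i≤j)

  1+i≢j : suc i ≢ j
  1+i≢j 1+i≡j = <-irrefl 1+i≡j 2+i≤j

  start-j : ∀ c → c ≤ a j → j ∸ subAt a j c j ≡ i + c
  start-j c c≤aj = begin
    j ∸ subAt a j c j   ≡⟨ cong (j ∸_) (subAt-at a j c) ⟩
    j ∸ (a j ∸ c)       ≡⟨ ∸-∸ c≤aj aj≤j ⟩
    j ∸ a j + c         ≡⟨ cong (_+ c) i≡j∸aj ⟨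
    i + c               ∎
    where open ≡-Reasoning

  start1-j : j ∸ a1 j ≡ suc i
  start1-j = trans (start-j 1 (≤-trans (n≤1+n 1) 2≤aj)) (+-comm i 1)

  start2-j : j ∸ a2 j ≡ suc (suc i)
  start2-j = trans (start-j 2 2≤aj) (+-comm i 2)

  -- Since a (i + 1) = a i + 1, the vertices i and i + 1 have the same start.
  start1-1+i : suc i ∸ a1 (suc i) ≡ i ∸ a1 i
  start1-1+i = begin
    suc i ∸ a1 (suc i)   ≡⟨ cong (suc i ∸_) (subAt-away a j 1 1+i≢j) ⟩
    suc i ∸ a (suc i)    ≡⟨ cong (suc i ∸_) (trans (sym ai+1≡ai+1) (+-comm (a i) 1)) ⟩
    i ∸ a i              ≡⟨ cong (i ∸_) (subAt-away a j 1 i≢j) ⟨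
    i ∸ a1 i             ∎
    where open ≡-Reasoning

  -- No vertex v > i + 1 other than j has its in-neighbourhood starting at
  -- i + 1: before j the start is at most i, and after j (which then is not
  -- the last vertex, so a drops there) it is at least i + 2.
  start-avoids-1+i : ∀ {v} → suc i < v → v ≤ n → v ≢ j → v ∸ a v ≢ suc i
  start-avoids-1+i {v} 1+i<v v≤n v≢j start≡ with <-cmp v j
  ... | tri≈ _ v≡j _ = v≢j v≡j
  ... | tri< v<j _ _ = <-irrefl refl (begin-strict
    suc i      ≡⟨ start≡ ⟨
    v ∸ a v    ≤⟨ start-mono isArea (≤-trans (s≤s z≤n) 1+i<v) (<⇒≤ v<j) j≤n ⟩
    j ∸ a j    ≡⟨ i≡j∸aj ⟨
    i          <⟨ n<1+n i ⟩
    suc i      ∎)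
    where open ≤-Reasoning
  ... | tri> _ _ j<v = after-j last-or-drop
    where
    open ≤-Reasoning
    after-j : j ≡ n ⊎ a (suc j) + 1 ≤ a j → ⊥
    after-j (inj₁ j≡n)  = <-irrefl refl (≤-trans j<v (subst (v ≤_) (sym j≡n) v≤n))
    after-j (inj₂ drop) = <-irrefl refl (begin-strict
      suc i                <⟨ n<1+n (suc i) ⟩
      suc (suc i)          ≡⟨ +-comm 1 (suc i) ⟩
      suc i + 1            ≡⟨ cong (λ t → suc t + 1) i≡j∸aj ⟩
      suc (j ∸ a j) + 1    ≡⟨ cong (_+ 1) (+-∸-assoc 1 aj≤j) ⟨
      suc j ∸ a j + 1      ≡⟨ ∸-∸ (≤-trans (n≤1+n 1) 2≤aj) (m≤n⇒m≤1+n aj≤j) ⟨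
      suc j ∸ (a j ∸ 1)    ≤⟨ ∸-monoʳ-≤ (suc j) (m+n≤o⇒m≤o∸n (a (suc j)) drop) ⟩
      suc j ∸ a (suc j)    ≤⟨ start-mono isArea (s≤s z≤n) j<v v≤n ⟩
      v ∸ a v              ≡⟨ start≡ ⟩
      suc i                ∎)

  E1-i-1+i : E1 i (suc i)
  E1-i-1+i = 1≤i , 1+i≤n , subst (_≤ i) (sym start1-1+i) (m∸n≤m i (a1 i)) , n<1+n i

  E1-1+i-j : E1 (suc i) j
  E1-1+i-j = s≤s z≤n , j≤n , ≤-reflexive start1-j , 2+i≤j

  ¬E1-i-j : ¬ E1 i j
  ¬E1-i-j (_ , _ , start≤i , _) = <-irrefl refl (subst (_≤ i) start1-j start≤i)

  ¬E2-1+i-j : ¬ E2 (suc i) j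
  ¬E2-1+i-j (_ , _ , start≤1+i , _) = <-irrefl refl (subst (_≤ suc i) start2-j start≤1+i)

  E1⇔E2 : ∀ {u v} → (u , v) ≢ (suc i , j) → E1 u v ⇔ E2 u v
  E1⇔E2 {u} {v} ≢B with v ≟ j
  ... | no v≢j = mk⇔ (edge-transport n a1 a2 (subst (λ t → v ∸ t ≤ u) (a1≡a2 v≢j)))
                     (edge-transport n a2 a1 (subst (λ t → v ∸ t ≤ u) (sym (a1≡a2 v≢j))))
    where
    a1≡a2 : ∀ {w} → w ≢ j → a1 w ≡ a2 w
    a1≡a2 w≢j = trans (subAt-away a j 1 w≢j) (sym (subAt-away a j 2 w≢j))
  ... | yes refl = mk⇔ (edge-transport n a1 a2 to) (edge-transport n a2 a1 from)
    where
    to : j ∸ a1 j ≤ u → j ∸ a2 j ≤ u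
    to start≤u = subst (_≤ u) (sym start2-j)
      (≤∧≢⇒< (subst (_≤ u) start1-j start≤u) (λ 1+i≡u → ≢B (cong (_, j) (sym 1+i≡u))))
    from : j ∸ a2 j ≤ u → j ∸ a1 j ≤ u
    from start≤u = subst (_≤ u) (sym start1-j) (≤-trans (n≤1+n (suc i)) (subst (_≤ u) start2-j start≤u))

  out-i⇔out-1+i : ∀ {v} → suc i < v → v ≤ n → v ≢ j → E1 i v ⇔ E1 (suc i) v
  out-i⇔out-1+i {v} 1+i<v v≤n v≢j =
    mk⇔ (λ (_ , v≤n , start≤i , _) → s≤s z≤n , v≤n , m≤n⇒m≤1+n start≤i , 1+i<v)
        (λ (_ , v≤n , start≤1+i , _) → 1≤i , v≤n , ≤-pred (≤∧≢⇒< start≤1+i start≢1+i) , <-trans (n<1+n i) 1+i<v)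
    where
    start≢1+i : v ∸ a1 v ≢ suc i
    start≢1+i = start-avoids-1+i 1+i<v v≤n v≢j ∘ trans (cong (v ∸_) (sym (subAt-away a j 1 v≢j)))

  in-i⇔in-1+i : ∀ {u} → u < i → E1 u i ⇔ E1 u (suc i)
  in-i⇔in-1+i {u} u<i =
    mk⇔ (λ (1≤u , _ , start≤u , u<i) → 1≤u , 1+i≤n , subst (_≤ u) (sym start1-1+i) start≤u , m≤n⇒m≤1+n u<i)
        (λ (1≤u , _ , start≤u , _) → 1≤u , ≤-trans (n≤1+n i) 1+i≤n , subst (_≤ u) start1-1+i start≤u , u<i)

  τ : ℕ → ℕ
  τ = transpose i

  τ-j : τ j ≡ j
  τ-j = transpose-other i j (i≢j ∘ sym) (1+i≢j ∘ sym)

  E1-τ : ∀ {u v} → u < v → v ≤ n →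
    (u , v) ≢ (i , suc i) → (u , v) ≢ (suc i , j) → (u , v) ≢ (i , j) → E1 u v ⇔ E1 (τ u) (τ v)
  E1-τ {u} {v} u<v v≤n ≢A ≢B ≢D with u ≟ i | u ≟ suc i
  ... | yes refl | _
    rewrite transpose-k i | transpose-other i v (>⇒≢ u<v) (≢A ∘ cong (i ,_)) =
    out-i⇔out-1+i (≤∧≢⇒< u<v (≢A ∘ cong (i ,_) ∘ sym)) v≤n (≢D ∘ cong (i ,_))
  ... | no _ | yes refl
    rewrite transpose-suc-k i | transpose-other i v (>⇒≢ (<-trans (n<1+n i) u<v)) (>⇒≢ u<v) =
    ⇔-sym (out-i⇔out-1+i u<v v≤n (≢B ∘ cong (suc i ,_)))
  ... | no u≢i | no u≢1+i with v ≟ i | v ≟ suc i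
  ...   | yes refl | _ rewrite transpose-other i u u≢i u≢1+i | transpose-k i = in-i⇔in-1+i u<v
  ...   | no _ | yes refl rewrite transpose-other i u u≢i u≢1+i | transpose-suc-k i =
    ⇔-sym (in-i⇔in-1+i (≤∧≢⇒< (≤-pred u<v) u≢i))
  ...   | no v≢i | no v≢1+i rewrite transpose-other i u u≢i u≢1+i | transpose-other i v v≢i v≢1+i = ⇔-id _

  colour-i colour-1+i colour-j : List ℕ → ℕ
  colour-i   κ = col κ i
  colour-1+i κ = col κ (suc i)
  colour-j   κ = col κ j

  Exchanged : List ℕ → Set
  Exchanged κ = Straddles (colour-i κ) (colour-1+i κ) (colour-j κ)

  exchanged? : ∀ κ → Dec (Exchanged κ)
  exchanged? κ = straddles? (colour-i κ) (colour-1+i κ) (colour-j κ)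

  sw : List ℕ → List ℕ
  sw = swapAdjacent (i ∸ 1)

  col-sw : ∀ κ → length κ ≡ n → ∀ w → 1 ≤ w → col (sw κ) w ≡ col κ (τ w)
  col-sw κ length≡n = col-swapAdjacent κ 1≤i (subst (i <_) (sym length≡n) 1+i≤n)

  colour-i-sw : ∀ κ → length κ ≡ n → colour-i (sw κ) ≡ colour-1+i κ
  colour-i-sw κ length≡n = trans (col-sw κ length≡n i 1≤i) (cong (col κ) (transpose-k i))

  colour-1+i-sw : ∀ κ → length κ ≡ n → colour-1+i (sw κ) ≡ colour-i κ
  colour-1+i-sw κ length≡n = trans (col-sw κ length≡n (suc i) (s≤s z≤n)) (cong (col κ) (transpose-suc-k i))

  colour-j-sw : ∀ κ → length κ ≡ n → colour-j (sw κ) ≡ colour-j κ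
  colour-j-sw κ length≡n = trans (col-sw κ length≡n j 1≤j) (cong (col κ) τ-j)

  exchanged-sw : ∀ κ → length κ ≡ n → Exchanged κ → Exchanged (sw κ)
  exchanged-sw κ length≡n exchanged =
    straddles-resp (colour-i-sw κ length≡n) (colour-1+i-sw κ length≡n) (colour-j-sw κ length≡n) (straddles-swap exchanged)
    where
    straddles-resp : ∀ {x x′ y y′ z z′} → x′ ≡ x → y′ ≡ y → z′ ≡ z → Straddles x y z → Straddles x′ y′ z′
    straddles-resp refl refl refl straddles = straddles

  φ : List ℕ → List ℕ
  φ κ = if does (exchanged? κ) then sw κ else κ

  φ-exchanged : ∀ κ → Exchanged κ → φ κ ≡ sw κ
  φ-exchanged κ exchanged rewrite dec-true (exchanged? κ) exchanged = refl

  φ-fixed : ∀ κ → ¬ Exchanged κ → φ κ ≡ κ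
  φ-fixed κ ¬exchanged rewrite dec-false (exchanged? κ) ¬exchanged = refl

  Ascent : (ℕ → ℕ) → List ℕ → ℕ × ℕ → Set
  Ascent b κ p = Edge n b (proj₁ p) (proj₂ p) × col κ (proj₁ p) < col κ (proj₂ p)

  ascent? : ∀ b κ p → Dec (Ascent b κ p)
  ascent? b κ p = edge? n b (proj₁ p) (proj₂ p) ×-dec (col κ (proj₁ p) <? col κ (proj₂ p))

  pairs : List (ℕ × ℕ)
  pairs = allPairs n

  asc-a1≡1+asc-a2 : ∀ κ → colour-1+i κ < colour-j κ → asc n a1 κ ≡ suc (asc n a2 κ)
  asc-a1≡1+asc-a2 κ ascending = count-one-more (ascent? a1 κ) (ascent? a2 κ) pairs (allPairs-unique n)
    (allPairs-∈⁺ n 2+i≤j j≤n) (λ _ p≢B → E1⇔E2 p≢B ×-⇔ ⇔-id _) (E1-1+i-j , ascending) (¬E2-1+i-j ∘ proj₁)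

  PA PB PD : ℕ × ℕ
  PA = (i , suc i)
  PB = (suc i , j)
  PD = (i , j)

  τ² : ℕ × ℕ → ℕ × ℕ
  τ² p = (τ (proj₁ p) , τ (proj₂ p))

  _≟₂_ : (p q : ℕ × ℕ) → Dec (p ≡ q)
  _≟₂_ = ≡-dec _≟_ _≟_

  π : ℕ × ℕ → ℕ × ℕ
  π p = if does (p ≟₂ PA) then PB else if does (p ≟₂ PB) then PA else if does (p ≟₂ PD) then PD else τ² p

  PA≢PB : PA ≢ PB
  PA≢PB = <⇒≢ (n<1+n i) ∘ cong proj₁

  PA≢PD : PA ≢ PD
  PA≢PD = 1+i≢j ∘ cong proj₂

  PB≢PD : PB ≢ PD
  PB≢PD = 1+n≢n ∘ cong proj₁

  π-A : π PA ≡ PB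
  π-A rewrite dec-true (PA ≟₂ PA) refl = refl

  π-B : π PB ≡ PA
  π-B rewrite dec-false (PB ≟₂ PA) (PA≢PB ∘ sym) | dec-true (PB ≟₂ PB) refl = refl

  π-D : π PD ≡ PD
  π-D rewrite dec-false (PD ≟₂ PA) (PA≢PD ∘ sym) | dec-false (PD ≟₂ PB) (PB≢PD ∘ sym)
            | dec-true (PD ≟₂ PD) refl = refl

  π-other : ∀ {p} → p ≢ PA → p ≢ PB → p ≢ PD → π p ≡ τ² p
  π-other {p} ≢A ≢B ≢D rewrite dec-false (p ≟₂ PA) ≢A | dec-false (p ≟₂ PB) ≢B | dec-false (p ≟₂ PD) ≢D = refl

  data PairKind : ℕ × ℕ → Set where
    pair-A : PairKind PA
    pair-B : PairKind PB
    pair-D : PairKind PD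
    pair-other : ∀ {p} → p ≢ PA → p ≢ PB → p ≢ PD → PairKind p

  pairKind : ∀ p → PairKind p
  pairKind p with p ≟₂ PA | p ≟₂ PB | p ≟₂ PD
  ... | yes refl | _        | _        = pair-A
  ... | no _     | yes refl | _        = pair-B
  ... | no _     | no _     | yes refl = pair-D
  ... | no ≢A    | no ≢B    | no ≢D    = pair-other ≢A ≢B ≢D

  τ²-involutive : ∀ p → τ² (τ² p) ≡ p
  τ²-involutive p = cong₂ _,_ (transpose-involutive i (proj₁ p)) (transpose-involutive i (proj₂ p))

  τ²-flip : ∀ {p q} → τ² p ≡ q → p ≡ τ² q
  τ²-flip {p} τ²p≡q = trans (sym (τ²-involutive p)) (cong τ² τ²p≡q)

  τ-< : ∀ {u v} → u < v → (u , v) ≢ PA → τ u < τ v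
  τ-< {u} {v} u<v ≢A with u ≟ i | u ≟ suc i
  ... | yes refl | _ rewrite transpose-k i | transpose-other i v (>⇒≢ u<v) (≢A ∘ cong (i ,_)) =
    ≤∧≢⇒< u<v (≢A ∘ cong (i ,_) ∘ sym)
  ... | no _ | yes refl rewrite transpose-suc-k i | transpose-other i v (>⇒≢ (<-trans (n<1+n i) u<v)) (>⇒≢ u<v) =
    <-trans (n<1+n i) u<v
  ... | no u≢i | no u≢1+i with v ≟ i | v ≟ suc i
  ...   | yes refl | _ rewrite transpose-other i u u≢i u≢1+i | transpose-k i = <-trans u<v (n<1+n i)
  ...   | no _ | yes refl rewrite transpose-other i u u≢i u≢1+i | transpose-suc-k i = ≤∧≢⇒< (≤-pred u<v) u≢i
  ...   | no v≢i | no v≢1+i rewrite transpose-other i u u≢i u≢1+i | transpose-other i v v≢i v≢1+i = u<v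

  τ-≤n : ∀ {w} → w ≤ n → τ w ≤ n
  τ-≤n {w} w≤n with w ≟ i | w ≟ suc i
  ... | yes refl | _      rewrite transpose-k i     = 1+i≤n
  ... | no _   | yes refl rewrite transpose-suc-k i = ≤-trans (n≤1+n i) 1+i≤n
  ... | no w≢i | no w≢1+i rewrite transpose-other i w w≢i w≢1+i = w≤n

  π-closed : ∀ {p} → p ∈ pairs → π p ∈ pairs
  π-closed {p} p∈ with pairKind p
  ... | pair-A = subst (_∈ pairs) (sym π-A) (allPairs-∈⁺ n 2+i≤j j≤n)
  ... | pair-B = subst (_∈ pairs) (sym π-B) (allPairs-∈⁺ n (n<1+n i) 1+i≤n)
  ... | pair-D = subst (_∈ pairs) (sym π-D) p∈
  ... | pair-other ≢A ≢B ≢D = subst (_∈ pairs) (sym (π-other ≢A ≢B ≢D))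
    (allPairs-∈⁺ n (τ-< (proj₁ (allPairs-∈⁻ n p∈)) ≢A) (τ-≤n (proj₂ (allPairs-∈⁻ n p∈))))

  π-involutive : ∀ {p} → p ∈ pairs → π (π p) ≡ p
  π-involutive {p} p∈ with pairKind p
  ... | pair-A = trans (cong π π-A) π-B
  ... | pair-B = trans (cong π π-B) π-A
  ... | pair-D = trans (cong π π-D) π-D
  ... | pair-other ≢A ≢B ≢D = begin
    π (π p)       ≡⟨ cong π (π-other ≢A ≢B ≢D) ⟩
    π (τ² p)      ≡⟨ π-other τ²p≢A τ²p≢B τ²p≢D ⟩
    τ² (τ² p)     ≡⟨ τ²-involutive p ⟩
    p             ∎
    where
    open ≡-Reasoning
    τ²p≢A : τ² p ≢ PA
    τ²p≢A τ²p≡A = <-asym (n<1+n i) (subst₂ _<_ (trans (cong proj₁ p≡) (transpose-k i))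
                                              (trans (cong proj₂ p≡) (transpose-suc-k i)) (proj₁ (allPairs-∈⁻ n p∈)))
      where
      p≡ : p ≡ τ² PA
      p≡ = τ²-flip τ²p≡A
    τ²p≢B : τ² p ≢ PB
    τ²p≢B τ²p≡B = ≢D (trans (τ²-flip τ²p≡B) (cong₂ _,_ (transpose-suc-k i) τ-j))
    τ²p≢D : τ² p ≢ PD
    τ²p≢D τ²p≡D = ≢B (trans (τ²-flip τ²p≡D) (cong₂ _,_ (transpose-k i) τ-j))

  ascent-τ : ∀ κ → length κ ≡ n → ∀ {u v} → u < v → v ≤ n →
    (u , v) ≢ PA → (u , v) ≢ PB → (u , v) ≢ PD → Ascent a1 κ (τ u , τ v) ⇔ Ascent a1 (sw κ) (u , v)
  ascent-τ κ length≡n {u} {v} u<v v≤n ≢A ≢B ≢D = mk⇔ to from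
    where
    edges : E1 u v ⇔ E1 (τ u) (τ v)
    edges = E1-τ u<v v≤n ≢A ≢B ≢D
    colours : 1 ≤ u → col (sw κ) u < col (sw κ) v ⇔ col κ (τ u) < col κ (τ v)
    colours 1≤u = <-resp (col-sw κ length≡n u 1≤u) (col-sw κ length≡n v (≤-trans 1≤u (<⇒≤ u<v)))
    to : Ascent a1 κ (τ u , τ v) → Ascent a1 (sw κ) (u , v)
    to (τu→τv , ascending) with u→v ← Equivalence.from edges τu→τv =
      u→v , Equivalence.from (colours (proj₁ u→v)) ascending
    from : Ascent a1 (sw κ) (u , v) → Ascent a1 κ (τ u , τ v)
    from (u→v , ascending) = Equivalence.to edges u→v , Equivalence.to (colours (proj₁ u→v)) ascending

  ascent-π : ∀ κ → length κ ≡ n → Exchanged κ → ∀ {p} → p ∈ pairs → Ascent a1 κ (π p) ⇔ Ascent a1 (sw κ) p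
  ascent-π κ length≡n exchanged {p} p∈ with pairKind p
  ... | pair-A = subst (λ q → Ascent a1 κ q ⇔ Ascent a1 (sw κ) PA) (sym π-A)
    (holds E1-1+i-j E1-i-1+i ×-⇔ (⇔-sym (<-resp (colour-i-sw κ length≡n) (colour-1+i-sw κ length≡n))
                                   ⇔-∘ proj₁ (straddles-compare exchanged)))
  ... | pair-B = subst (λ q → Ascent a1 κ q ⇔ Ascent a1 (sw κ) PB) (sym π-B)
    (holds E1-i-1+i E1-1+i-j ×-⇔ (⇔-sym (<-resp (colour-1+i-sw κ length≡n) (colour-j-sw κ length≡n))
                                   ⇔-∘ proj₂ (straddles-compare exchanged)))
  ... | pair-D = subst (λ q → Ascent a1 κ q ⇔ Ascent a1 (sw κ) PD) (sym π-D)
    (mk⇔ (⊥-elim ∘ ¬E1-i-j ∘ proj₁) (⊥-elim ∘ ¬E1-i-j ∘ proj₁))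
  ... | pair-other ≢A ≢B ≢D = subst (λ q → Ascent a1 κ q ⇔ Ascent a1 (sw κ) p) (sym (π-other ≢A ≢B ≢D))
    (ascent-τ κ length≡n (proj₁ (allPairs-∈⁻ n p∈)) (proj₂ (allPairs-∈⁻ n p∈)) ≢A ≢B ≢D)

  asc-sw : ∀ κ → length κ ≡ n → Exchanged κ → asc n a1 (sw κ) ≡ asc n a1 κ
  asc-sw κ length≡n exchanged = begin
    length (filter (ascent? a1 (sw κ)) pairs)            ≡⟨ length-map π (filter (ascent? a1 (sw κ)) pairs) ⟨
    length (map π (filter (ascent? a1 (sw κ)) pairs))    ≡⟨ ↭-length (filter-involution-↭ (ascent? a1 (sw κ)) (ascent? a1 κ)
                                                              π (allPairs-unique n) π-closed π-involutive (ascent-π κ length≡n exchanged)) ⟩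
    length (filter (ascent? a1 κ) pairs)                 ∎
    where open ≡-Reasoning

  module _ (m : ℕ) where

    colourings : List (List ℕ)
    colourings = allColorings m n

    length-≡n : ∀ {κ} → κ ∈ colourings → length κ ≡ n
    length-≡n κ∈ = proj₁ (allColorings-∈⁻ m n κ∈)

    φ-closed : ∀ {κ} → κ ∈ colourings → φ κ ∈ colourings
    φ-closed {κ} κ∈ with exchanged? κ
    ... | yes exchanged = subst (_∈ colourings) (sym (φ-exchanged κ exchanged))
      (allColorings-∈⁺ m n (coloring-↭ (↭-sym (swapAdjacent-↭ (i ∸ 1) κ)) (allColorings-∈⁻ m n κ∈)))
    ... | no ¬exchanged = subst (_∈ colourings) (sym (φ-fixed κ ¬exchanged)) κ∈

    φ-involutive : ∀ {κ} → κ ∈ colourings → φ (φ κ) ≡ κ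
    φ-involutive {κ} κ∈ with exchanged? κ
    ... | yes exchanged = begin
      φ (φ κ)      ≡⟨ cong φ (φ-exchanged κ exchanged) ⟩
      φ (sw κ)     ≡⟨ φ-exchanged (sw κ) (exchanged-sw κ (length-≡n κ∈) exchanged) ⟩
      sw (sw κ)    ≡⟨ swapAdjacent-involutive (i ∸ 1) κ ⟩
      κ            ∎
      where open ≡-Reasoning
    ... | no ¬exchanged = trans (cong φ (φ-fixed κ ¬exchanged)) (φ-fixed κ ¬exchanged)

    φ-valid : ∀ {κ} → κ ∈ colourings → Valid ((suc i , j) ∷ []) (φ κ) ⇔ Valid ((i , j) ∷ []) κ
    φ-valid {κ} κ∈ = ⇔-sym (valid-single κ) ⇔-∘ (colours ⇔-∘ valid-single (φ κ))
      where
      colours : colour-1+i (φ κ) < colour-j (φ κ) ⇔ colour-i κ < colour-j κ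
      colours = decide (exchanged? κ)
        where
        decide : Dec (Exchanged κ) → colour-1+i (φ κ) < colour-j (φ κ) ⇔ colour-i κ < colour-j κ
        decide (yes exchanged) = subst (λ κ′ → colour-1+i κ′ < colour-j κ′ ⇔ colour-i κ < colour-j κ)
          (sym (φ-exchanged κ exchanged)) (<-resp (colour-1+i-sw κ (length-≡n κ∈)) (colour-j-sw κ (length-≡n κ∈)))
        decide (no ¬exchanged) = subst (λ κ′ → colour-1+i κ′ < colour-j κ′ ⇔ colour-i κ < colour-j κ)
          (sym (φ-fixed κ ¬exchanged)) (not-straddles ¬exchanged)

    weight : List ℕ → List ℕ × ℕ
    weight κ = content m κ , asc n a1 κ

    weight-φ : ∀ {κ} → κ ∈ colourings → weight (φ κ) ≡ weight κ
    weight-φ {κ} κ∈ with exchanged? κ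
    ... | yes exchanged = trans (cong weight (φ-exchanged κ exchanged))
      (cong₂ _,_ (content-↭ m (swapAdjacent-↭ (i ∸ 1) κ)) (asc-sw κ (length-≡n κ∈) exchanged))
    ... | no ¬exchanged = cong weight (φ-fixed κ ¬exchanged)

    G-identity : G m n a1 ((i , j) ∷ []) ↭ timesQ (G m n a2 ((suc i , j) ∷ []))
    G-identity = begin
      map weight F1                          ≡⟨ map-cong-local (All.tabulate (sym ∘ weight-φ ∘ proj₁ ∘ ∈-filter⁻ (valid? s1))) ⟩
      map (weight ∘ φ) F1                    ≡⟨ map-∘ F1 ⟩
      map weight (map φ F1)                  ↭⟨ ↭-map⁺ weight (filter-involution-↭ (valid? s1) (valid? s2) φ
                                                  (allColorings-unique m n) φ-closed φ-involutive φ-valid) ⟩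
      map weight F2                          ≡⟨ map-cong-local (All.tabulate (shift ∘ ∈-filter⁻ (valid? s2))) ⟩
      map (λ κ → content m κ , suc (asc n a2 κ)) F2   ≡⟨ map-∘ F2 ⟩
      timesQ (G m n a2 s2)                   ∎
      where
      open PermutationReasoning
      s1 s2 : List (ℕ × ℕ)
      s1 = (i , j) ∷ []
      s2 = (suc i , j) ∷ []
      F1 F2 : List (List ℕ)
      F1 = filter (valid? s1) colourings
      F2 = filter (valid? s2) colourings
      shift : ∀ {κ} → κ ∈ colourings × Valid s2 κ → weight κ ≡ (content m κ , suc (asc n a2 κ))
      shift {κ} (_ , valid) = cong (content m κ ,_) (asc-a1≡1+asc-a2 κ (Equivalence.to (valid-single κ) valid))

proposition3p4 : (n : ℕ) (a : ℕ → ℕ) (i j : ℕ) →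
    3 ≤ n → IsAreaSeq n a → Admissible n a i j →
    (m : ℕ) →
    G m n (subAt a j 1) ((i , j) ∷ []) ↭ timesQ (G m n (subAt a j 2) ((suc i , j) ∷ []))
proposition3p4 n a i j _ isArea ((1≤i , _) , _ , j≤n , i≡j∸aj , last-or-drop , 2≤aj , ai+1≡ai+1) m =
  AdmissibleEdge.G-identity n a i j isArea 1≤i j≤n i≡j∸aj last-or-drop 2≤aj ai+1≡ai+1 m
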